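{- For any signed graph $(G,\sigma)$, $AT(G,\sigma)$ equals the minimum $k$ for which there exists an orientation $D$ of $G$ such that $|\sigma EE(D)|\neq|\sigma OE(D)|$ and every vertex has outdegree less than $k$ in $D$.
   Context: A signed graph $(G,\sigma)$ consists of a finite simple graph $G$ and $\sigma\colon E(G)\to\{+1,-1\}$; edges with $\sigma=+1$ are positive. Fix a linear ordering $<$ of $V(G)$; the graph polynomial is $P_{G,\sigma}(\mathbf{x})=\prod_{uv\in E(G),\,u<v}(x_u-\sigma(uv)x_v)$, and the Alon–Tarsi number $AT(G,\sigma)$ is the minimum $k$ such that the expansion of $P_{G,\sigma}(\mathbf{x})$ contains a monomial $c\prod_v x_v^{t_v}$ with $c\neq 0$ and $t_v<k$ for all $v$. For an orientation $D$ of $G$, an Eulerian subdigraph of $D$ is a spanning subdigraph (not necessarily connected, possibly edgeless) in which every vertex has indegree equal to outdegree; it is $\sigma$-even (resp. $\sigma$-odd) if it contains an even (resp. odd) number of positive edges. $\sigma EE(D)$ and $\sigma OE(D)$ denote the sets of $\sigma$-even and $\sigma$-odd Eulerian subdigraphs of $D$. -}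

module Defs where

open import Data.Nat using (ℕ; zero; suc; _+_; _<_; _%_)
open import Data.Integer as ℤ using (ℤ)
open import Data.Fin using (Fin; _<_)
open import Data.Fin.Properties as FinP using (_≟_)
open import Data.Vec using (Vec; []; _∷_; lookup; replicate; zipWith; updateAt)
import Data.Vec.Properties as VecP
open import Data.List using (List; []; _∷_; _++_; map; concatMap; foldr; filter; length; allFin; sum)
open import Data.Product using (_×_; _,_; proj₁; proj₂; ∃)
open import Data.Bool using (Bool; true; false; if_then_else_)
open import Relation.Binary.PropositionalEquality using (_≡_; _≢_)
open import Relation.Nullary using (Dec; ¬_)
open import Relation.Nullary.Decidable using (⌊_⌋; _×-dec_)
open import Data.Bool using (_∧_)
open import Relation.Unary using (Decidable)
import Data.Nat.Properties as ℕP
open import Function.Definitions using (Injective)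

data Sign : Set where
  pos neg : Sign

-- Edge e joins
-- endpoints (fst e) < (snd e) in the linear order of Fin n (the fixed
-- linear ordering of V(G)); the edge map is injective (simple graph:
-- no loops since fst < snd, no parallel edges by injectivity).
record SignedGraph (n m : ℕ) : Set where
  field
    edge     : Fin m → Fin n × Fin n
    ordered  : ∀ e → proj₁ (edge e) Data.Fin.< proj₂ (edge e)
    simple   : Injective _≡_ _≡_ edge
    σ        : Fin m → Sign

open SignedGraph public

-- The graph polynomial, as a formal (unsimplified) sum of terms
-- c · x^t, with t an exponent vector.

Term : ℕ → Set
Term n = ℤ × Vec ℕ n

Poly : ℕ → Set
Poly n = List (Term n)

unitExp : ∀ {n} → Fin n → Vec ℕ n
unitExp {n} i = updateAt (replicate n 0) i (λ _ → 1)

termMul : ∀ {n} → Term n → Term n → Term n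
termMul (c , t) (d , s) = (c ℤ.* d , zipWith _+_ t s)

polyMul : ∀ {n} → Poly n → Poly n → Poly n
polyMul p q = concatMap (λ a → map (termMul a) q) p

polyOne : ∀ {n} → Poly n
polyOne {n} = (ℤ.1ℤ , replicate n 0) ∷ []

signCoeff : Sign → ℤ
signCoeff pos = ℤ.1ℤ
signCoeff neg = ℤ.-1ℤ

edgeFactor : ∀ {n m} → SignedGraph n m → Fin m → Poly n
edgeFactor G e =
  (ℤ.1ℤ , unitExp (proj₁ (edge G e))) ∷
  (ℤ.- signCoeff (σ G e) , unitExp (proj₂ (edge G e))) ∷ []

graphPoly : ∀ {n m} → SignedGraph n m → Poly n
graphPoly {m = m} G = foldr (λ e p → polyMul (edgeFactor G e) p) polyOne (allFin m)

coeff : ∀ {n} → Poly n → Vec ℕ n → ℤ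
coeff {n} p t =
  sum′ (map proj₁ (filter (λ a → VecP.≡-dec ℕP._≟_ (proj₂ a) t) p))
  where
  sum′ : List ℤ → ℤ
  sum′ = foldr ℤ._+_ ℤ.0ℤ

ATWitness : ∀ {n m} → SignedGraph n m → ℕ → Set
ATWitness {n} G k =
  ∃ λ (t : Vec ℕ n) → coeff (graphPoly G) t ≢ ℤ.0ℤ × (∀ v → lookup t v Data.Nat.< k)

-- An orientation: true = edge oriented from proj₁ to proj₂, false = reverse.
Orientation : ℕ → Set
Orientation m = Vec Bool m

tail : ∀ {n m} → SignedGraph n m → Orientation m → Fin m → Fin n
tail G D e = if lookup D e then proj₁ (edge G e) else proj₂ (edge G e)

head : ∀ {n m} → SignedGraph n m → Orientation m → Fin m → Fin n
head G D e = if lookup D e then proj₂ (edge G e) else proj₁ (edge G e)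

outdeg : ∀ {n m} → SignedGraph n m → Orientation m → Fin n → ℕ
outdeg {m = m} G D v = length (filter (λ e → tail G D e ≟ v) (allFin m))

-- A spanning subdigraph of D is determined by its edge set S ⊆ E(D).
EdgeSubset : ℕ → Set
EdgeSubset m = Vec Bool m

inSub : ∀ {m} → EdgeSubset m → Fin m → Set
inSub S e = lookup S e ≡ true

subOutdeg : ∀ {n m} → SignedGraph n m → Orientation m → EdgeSubset m → Fin n → ℕ
subOutdeg {m = m} G D S v =
  length (filter (λ e → (lookup S e ∧ ⌊ tail G D e ≟ v ⌋) Data.Bool.≟ true) (allFin m))

subIndeg : ∀ {n m} → SignedGraph n m → Orientation m → EdgeSubset m → Fin n → ℕ
subIndeg {m = m} G D S v =
  length (filter (λ e → (lookup S e ∧ ⌊ head G D e ≟ v ⌋) Data.Bool.≟ true) (allFin m))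

isPos : Sign → Bool
isPos pos = true
isPos neg = false

posCount : ∀ {n m} → SignedGraph n m → EdgeSubset m → ℕ
posCount {m = m} G S =
  length (filter (λ e → (lookup S e ∧ isPos (σ G e)) Data.Bool.≟ true) (allFin m))

Eulerian : ∀ {n m} → SignedGraph n m → Orientation m → EdgeSubset m → Set
Eulerian G D S = ∀ v → subIndeg G D S v ≡ subOutdeg G D S v

Eulerian? : ∀ {n m} (G : SignedGraph n m) (D : Orientation m) → Decidable (Eulerian G D)
Eulerian? G D S = FinP.all? (λ v → subIndeg G D S v ℕP.≟ subOutdeg G D S v)

σEven : ∀ {n m} → SignedGraph n m → EdgeSubset m → Set
σEven G S = posCount G S % 2 ≡ 0

σOdd : ∀ {n m} → SignedGraph n m → EdgeSubset m → Set
σOdd G S = posCount G S % 2 ≡ 1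

allSubsets : (m : ℕ) → List (EdgeSubset m)
allSubsets zero = [] ∷ []
allSubsets (suc m) = map (true ∷_) (allSubsets m) ++ map (false ∷_) (allSubsets m)

numσEE : ∀ {n m} → SignedGraph n m → Orientation m → ℕ
numσEE {m = m} G D =
  length (filter (λ S → Eulerian? G D S ×-dec (posCount G S % 2 ℕP.≟ 0)) (allSubsets m))

numσOE : ∀ {n m} → SignedGraph n m → Orientation m → ℕ
numσOE {m = m} G D =
  length (filter (λ S → Eulerian? G D S ×-dec (posCount G S % 2 ℕP.≟ 1)) (allSubsets m))

OrientWitness : ∀ {n m} → SignedGraph n m → ℕ → Set
OrientWitness {n} {m} G k =
  ∃ λ (D : Orientation m) → numσEE G D ≢ numσOE G D × (∀ v → outdeg G D v Data.Nat.< k)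

IsMinimum : (ℕ → Set) → ℕ → Set
IsMinimum P k = P k × (∀ j → P j → k Data.Nat.≤ j)

-- Expanding the graph polynomial edge by edge, a choice of x_u or of −σ(uv) x_v in every
-- factor is an orientation D of G, contributing ±x^{outdeg_D}.  Fix D and parametrise the
-- other orientations as D ⊕ S, S being the set of reversed edges: D ⊕ S has the same
-- outdegrees as D exactly when S is Eulerian in D, and reversing S changes the sign of the
-- contribution by (−1)^{#positive edges of S}.  Hence the coefficient of x^{outdeg_D} is
-- ±(|σEE(D)| − |σOE(D)|), so the monomials with nonzero coefficient are exactly the
-- outdegree vectors of orientations with |σEE(D)| ≠ |σOE(D)|.
module Submission where

open import Defs
open import Data.Nat as ℕ using (ℕ; zero; suc; _%_)
import Data.Nat.Properties as ℕP
import Data.Nat.DivMod as DivMod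
open import Data.Integer as ℤ using (ℤ; +_; 0ℤ; 1ℤ; -1ℤ; _^_)
import Data.Integer.Properties as ℤP
open import Data.Integer.Tactic.RingSolver using (solve-∀)
open import Data.Fin using (Fin; zero; suc)
import Data.Fin.Properties as FinP
open import Data.Vec using (Vec; []; _∷_; lookup; replicate; zipWith; tabulate)
import Data.Vec.Properties as VecP
open import Data.List as List using (List; []; _∷_; _++_; map; foldr; filter; length)
import Data.List.Properties as ListP
open import Data.Product using (_×_; _,_; proj₁; proj₂; ∃)
open import Data.Sum using (inj₁; inj₂)
open import Data.Bool using (Bool; true; false; if_then_else_; _∧_; _xor_)
import Data.Bool as Bool
open import Data.Empty using (⊥-elim)
open import Function using (_∘_; id; _⇔_; mk⇔; Equivalence)
open import Relation.Binary.PropositionalEquality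
open import Relation.Nullary using (Dec; yes; no; does)
open import Relation.Nullary.Decidable using (⌊_⌋; _×-dec_; isYes≗does; does-⇔)
open import Relation.Unary using (Decidable)
open import Algebra.Properties.CommutativeMonoid.Sum ℕP.+-0-commutativeMonoid
  using (sum; sum-cong-≗; ∑-distrib-+)

boolToℕ : Bool → ℕ
boolToℕ true  = 1
boolToℕ false = 0

length-filter-∷ : ∀ {a p} {A : Set a} {P : A → Set p} (P? : Decidable P) x xs →
  length (filter P? (x ∷ xs)) ≡ boolToℕ (does (P? x)) ℕ.+ length (filter P? xs)
length-filter-∷ P? x xs with does (P? x)
... | true  = refl
... | false = refl

length-filter-tabulate : ∀ {a p} {A : Set a} {P : A → Set p} (P? : Decidable P) {k} (f : Fin k → A) →
  length (filter P? (List.tabulate f)) ≡ sum (λ i → boolToℕ (does (P? (f i))))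
length-filter-tabulate P? {zero}  f = refl
length-filter-tabulate P? {suc k} f =
  trans (length-filter-∷ P? (f zero) _)
        (cong (boolToℕ (does (P? (f zero))) ℕ.+_) (length-filter-tabulate P? (f ∘ suc)))

count-true : ∀ {k} (b : Fin k → Bool) →
  length (filter (λ i → b i Bool.≟ true) (List.allFin k)) ≡ sum (boolToℕ ∘ b)
count-true b = trans (length-filter-tabulate (λ i → b i Bool.≟ true) id) (sum-cong-≗ (does-≟-true ∘ b))
  where
  does-≟-true : ∀ c → boolToℕ (does (c Bool.≟ true)) ≡ boolToℕ c
  does-≟-true true  = refl
  does-≟-true false = refl

sumOver : ∀ {a} {A : Set a} → List A → (A → ℤ) → ℤ
sumOver []       g = 0ℤ
sumOver (x ∷ xs) g = g x ℤ.+ sumOver xs g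

sumOver-++ : ∀ {a} {A : Set a} (xs ys : List A) (g : A → ℤ) →
  sumOver (xs ++ ys) g ≡ sumOver xs g ℤ.+ sumOver ys g
sumOver-++ []       ys g = sym (ℤP.+-identityˡ _)
sumOver-++ (x ∷ xs) ys g = trans (cong (ℤ._+_ (g x)) (sumOver-++ xs ys g)) (sym (ℤP.+-assoc (g x) _ _))

sumOver-map : ∀ {a b} {A : Set a} {B : Set b} (f : A → B) (xs : List A) (g : B → ℤ) →
  sumOver (map f xs) g ≡ sumOver xs (g ∘ f)
sumOver-map f []       g = refl
sumOver-map f (x ∷ xs) g = cong (ℤ._+_ (g (f x))) (sumOver-map f xs g)

sumOver-cong : ∀ {a} {A : Set a} (xs : List A) {f g : A → ℤ} → (∀ x → f x ≡ g x) →
  sumOver xs f ≡ sumOver xs g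
sumOver-cong []       f≗g = refl
sumOver-cong (x ∷ xs) f≗g = cong₂ ℤ._+_ (f≗g x) (sumOver-cong xs f≗g)

sumOver-*ˡ : ∀ {a} {A : Set a} (xs : List A) (c : ℤ) (f : A → ℤ) →
  sumOver xs (λ x → c ℤ.* f x) ≡ c ℤ.* sumOver xs f
sumOver-*ˡ []       c f = sym (ℤP.*-zeroʳ c)
sumOver-*ˡ (x ∷ xs) c f = trans (cong (ℤ._+_ (c ℤ.* f x)) (sumOver-*ˡ xs c f)) (sym (ℤP.*-distribˡ-+ c (f x) _))

sumOver≢0⇒∃ : ∀ {a} {A : Set a} (xs : List A) (g : A → ℤ) → sumOver xs g ≢ 0ℤ → ∃ λ x → g x ≢ 0ℤ
sumOver≢0⇒∃ []       g nz = ⊥-elim (nz refl)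
sumOver≢0⇒∃ (x ∷ xs) g nz with g x ℤ.≟ 0ℤ
... | no  gx≢0 = x , gx≢0
... | yes gx≡0 = sumOver≢0⇒∃ xs g (λ rest≡0 → nz (cong₂ ℤ._+_ gx≡0 rest≡0))

minus-+-minus : ∀ a b c d → (+ a ℤ.- + b) ℤ.+ (+ c ℤ.- + d) ≡ + (a ℕ.+ c) ℤ.- + (b ℕ.+ d)
minus-+-minus a b c d rewrite ℤP.pos-+ a c | ℤP.pos-+ b d = ring (+ a) (+ b) (+ c) (+ d)
  where
  ring : ∀ x y z u → (x ℤ.- y) ℤ.+ (z ℤ.- u) ≡ (x ℤ.+ z) ℤ.- (y ℤ.+ u)
  ring = solve-∀

-1^-suc-suc : ∀ k → -1ℤ ^ suc (suc k) ≡ -1ℤ ^ k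
-1^-suc-suc k = trans (ℤP.^-distribˡ-+-* -1ℤ 2 k) (ℤP.*-identityˡ (-1ℤ ^ k))

-1^-even : ∀ k → k % 2 ≡ 0 → -1ℤ ^ k ≡ 1ℤ
-1^-odd  : ∀ k → k % 2 ≡ 1 → -1ℤ ^ k ≡ -1ℤ
-1^-even zero          _  = refl
-1^-even (suc (suc k)) eq = trans (-1^-suc-suc k) (-1^-even k eq)
-1^-odd  (suc zero)    _  = refl
-1^-odd  (suc (suc k)) eq = trans (-1^-suc-suc k) (-1^-odd k eq)

sumOver-signedIndicator : ∀ {a p} {A : Set a} {P : A → Set p} (P? : Decidable P) (c : A → ℕ) (xs : List A) →
  sumOver xs (λ x → if does (P? x) then -1ℤ ^ c x else 0ℤ)
    ≡ + length (filter (λ x → P? x ×-dec (c x % 2 ℕP.≟ 0)) xs)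
      ℤ.- + length (filter (λ x → P? x ×-dec (c x % 2 ℕP.≟ 1)) xs)
sumOver-signedIndicator P? c []       = refl
sumOver-signedIndicator P? c (x ∷ xs) = begin
  term x ℤ.+ sumOver xs term
    ≡⟨ cong₂ ℤ._+_ (signedIndicator (P? x) (c x)) (sumOver-signedIndicator P? c xs) ⟩
  (+ ⟦ even? x ⟧ ℤ.- + ⟦ odd? x ⟧) ℤ.+ (+ length (filter even? xs) ℤ.- + length (filter odd? xs))
    ≡⟨ minus-+-minus ⟦ even? x ⟧ ⟦ odd? x ⟧ _ _ ⟩
  + (⟦ even? x ⟧ ℕ.+ length (filter even? xs)) ℤ.- + (⟦ odd? x ⟧ ℕ.+ length (filter odd? xs))
    ≡⟨ sym (cong₂ (λ e o → + e ℤ.- + o) (length-filter-∷ even? x xs) (length-filter-∷ odd? x xs)) ⟩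
  + length (filter even? (x ∷ xs)) ℤ.- + length (filter odd? (x ∷ xs)) ∎
  where
  open ≡-Reasoning
  term = λ y → if does (P? y) then -1ℤ ^ c y else 0ℤ
  even? = λ y → P? y ×-dec (c y % 2 ℕP.≟ 0)
  odd?  = λ y → P? y ×-dec (c y % 2 ℕP.≟ 1)
  ⟦_⟧ : ∀ {q} {Q : Set q} → Dec Q → ℕ
  ⟦ d ⟧ = boolToℕ (does d)
  signedIndicator : ∀ {q} {Q : Set q} (d : Dec Q) k →
    (if does d then -1ℤ ^ k else 0ℤ) ≡ + ⟦ d ×-dec (k % 2 ℕP.≟ 0) ⟧ ℤ.- + ⟦ d ×-dec (k % 2 ℕP.≟ 1) ⟧
  signedIndicator (no _)  k = refl
  signedIndicator (yes _) k with k % 2 in eq | DivMod.m%n<n k 2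
  ... | zero        | _ = -1^-even k eq
  ... | suc zero    | _ = -1^-odd k eq
  ... | suc (suc _) | ℕ.s≤s (ℕ.s≤s ())

if-then-*-else-0 : ∀ b (x y : ℤ) → (if b then x ℤ.* y else 0ℤ) ≡ x ℤ.* (if b then y else 0ℤ)
if-then-*-else-0 true  x y = refl
if-then-*-else-0 false x y = sym (ℤP.*-zeroʳ x)

_⊕_ : ∀ {k} → Vec Bool k → Vec Bool k → Vec Bool k
_⊕_ = zipWith _xor_

sumOver-allSubsets-∷ : ∀ {k} (g : Vec Bool (suc k) → ℤ) →
  sumOver (allSubsets (suc k)) g
    ≡ sumOver (allSubsets k) (g ∘ (true ∷_)) ℤ.+ sumOver (allSubsets k) (g ∘ (false ∷_))
sumOver-allSubsets-∷ {k} g = trans (sumOver-++ (map (true ∷_) (allSubsets k)) _ g)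
  (cong₂ ℤ._+_ (sumOver-map (true ∷_) (allSubsets k) g) (sumOver-map (false ∷_) (allSubsets k) g))

sumOver-allSubsets-⊕ : ∀ {k} (D : Vec Bool k) (g : Vec Bool k → ℤ) →
  sumOver (allSubsets k) g ≡ sumOver (allSubsets k) (λ S → g (D ⊕ S))
sumOver-allSubsets-⊕ []      g = refl
sumOver-allSubsets-⊕ (d ∷ D) g = begin
  sumOver (allSubsets _) g
    ≡⟨ sumOver-allSubsets-∷ g ⟩
  sumOver A (g ∘ (true ∷_)) ℤ.+ sumOver A (g ∘ (false ∷_))
    ≡⟨ cong₂ ℤ._+_ (sumOver-allSubsets-⊕ D (g ∘ (true ∷_))) (sumOver-allSubsets-⊕ D (g ∘ (false ∷_))) ⟩
  shifted true ℤ.+ shifted false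
    ≡⟨ halves d ⟩
  shifted (d xor true) ℤ.+ shifted (d xor false)
    ≡⟨ sym (sumOver-allSubsets-∷ (λ S → g ((d ∷ D) ⊕ S))) ⟩
  sumOver (allSubsets _) (λ S → g ((d ∷ D) ⊕ S)) ∎
  where
  open ≡-Reasoning
  A = allSubsets _
  shifted : Bool → ℤ
  shifted b = sumOver A (λ S → g (b ∷ D ⊕ S))
  halves : ∀ d → shifted true ℤ.+ shifted false ≡ shifted (d xor true) ℤ.+ shifted (d xor false)
  halves true  = ℤP.+-comm (shifted true) (shifted false)
  halves false = refl

coefficientOf : ∀ {n} → Term n → Vec ℕ n → ℤ
coefficientOf (c , s) t = if does (VecP.≡-dec ℕP._≟_ s t) then c else 0ℤ

coeff≡sumOver : ∀ {n} (p : Poly n) t → coeff p t ≡ sumOver p (λ a → coefficientOf a t)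
coeff≡sumOver []            t = refl
coeff≡sumOver ((c , s) ∷ p) t with does (VecP.≡-dec ℕP._≟_ s t)
... | true  = cong (ℤ._+_ c) (coeff≡sumOver p t)
... | false = trans (coeff≡sumOver p t) (sym (ℤP.+-identityˡ _))

coefficientOf≢0⇒≡ : ∀ {n} (a : Term n) t → coefficientOf a t ≢ 0ℤ → proj₂ a ≡ t
coefficientOf≢0⇒≡ (c , s) t nz with VecP.≡-dec ℕP._≟_ s t
... | yes s≡t = s≡t
... | no  _   = ⊥-elim (nz refl)

lookup-unitExp : ∀ {n} (i v : Fin n) → lookup (unitExp i) v ≡ boolToℕ (does (i FinP.≟ v))
lookup-unitExp {n} i v with i FinP.≟ v
... | yes refl = VecP.lookup∘updateAt i (replicate n 0)
... | no  i≢v  = trans (VecP.lookup∘updateAt′ v i (i≢v ∘ sym) (replicate n 0)) (VecP.lookup-replicate v 0)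

-- The coefficient of the chosen variable in the factor x_u − σ(uv) x_v: true picks x_u.
weight : Bool → Sign → ℤ
weight true  _ = 1ℤ
weight false s = ℤ.- signCoeff s

∣weight∣≡1 : ∀ d s → ℤ.∣ weight d s ∣ ≡ 1
∣weight∣≡1 true  _   = refl
∣weight∣≡1 false pos = refl
∣weight∣≡1 false neg = refl

weight-xor : ∀ d b s → weight (d xor b) s ≡ weight d s ℤ.* -1ℤ ^ boolToℕ (b ∧ isPos s)
weight-xor true  false _   = refl
weight-xor false false s   = sym (ℤP.*-identityʳ (weight false s))
weight-xor true  true  pos = refl
weight-xor false true  pos = refl
weight-xor true  true  neg = refl
weight-xor false true  neg = refl

outdegrees : ∀ {n m} → SignedGraph n m → Orientation m → Vec ℕ n
outdegrees G D = tabulate (outdeg G D)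

module _ {n m : ℕ} (G : SignedGraph n m) where

  endpoint : Bool → Fin m → Fin n
  endpoint b e = if b then proj₁ (edge G e) else proj₂ (edge G e)

  edgeTerm : Bool → Fin m → Term n
  edgeTerm b e = (weight b (σ G e) , unitExp (endpoint b e))

  orientationTerm : ∀ {k} → (Fin k → Fin m) → Vec Bool k → Term n
  orientationTerm h []      = (1ℤ , replicate n 0)
  orientationTerm h (d ∷ D) = termMul (edgeTerm d (h zero)) (orientationTerm (h ∘ suc) D)

  sign : Orientation m → ℤ
  sign D = proj₁ (orientationTerm id D)

  expand : ∀ {k} (h : Fin k → Fin m) →
    foldr (λ e p → polyMul (edgeFactor G e) p) polyOne (List.tabulate h) ≡ map (orientationTerm h) (allSubsets k)
  expand {zero}  h = refl
  expand {suc k} h = begin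
    polyMul (edgeFactor G e) (foldr (λ e′ p → polyMul (edgeFactor G e′) p) polyOne (List.tabulate (h ∘ suc)))
      ≡⟨ cong (polyMul (edgeFactor G e)) (expand (h ∘ suc)) ⟩
    map (termMul (edgeTerm true e)) X ++ (map (termMul (edgeTerm false e)) X ++ [])
      ≡⟨ cong₂ _++_ (sym (ListP.map-∘ A)) (trans (ListP.++-identityʳ _) (sym (ListP.map-∘ A))) ⟩
    map (orientationTerm h ∘ (true ∷_)) A ++ map (orientationTerm h ∘ (false ∷_)) A
      ≡⟨ cong₂ _++_ (ListP.map-∘ A) (ListP.map-∘ A) ⟩
    map (orientationTerm h) (map (true ∷_) A) ++ map (orientationTerm h) (map (false ∷_) A)
      ≡⟨ sym (ListP.map-++ (orientationTerm h) (map (true ∷_) A) _) ⟩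
    map (orientationTerm h) (allSubsets (suc k)) ∎
    where
    open ≡-Reasoning
    e = h zero
    A = allSubsets k
    X = map (orientationTerm (h ∘ suc)) A

  coeff-graphPoly : ∀ t →
    coeff (graphPoly G) t ≡ sumOver (allSubsets m) (λ D → coefficientOf (orientationTerm id D) t)
  coeff-graphPoly t = begin
    coeff (graphPoly G) t
      ≡⟨ coeff≡sumOver (graphPoly G) t ⟩
    sumOver (graphPoly G) (λ a → coefficientOf a t)
      ≡⟨ cong (λ p → sumOver p (λ a → coefficientOf a t)) (expand id) ⟩
    sumOver (map (orientationTerm id) (allSubsets m)) (λ a → coefficientOf a t)
      ≡⟨ sumOver-map (orientationTerm id) (allSubsets m) _ ⟩
    sumOver (allSubsets m) (λ D → coefficientOf (orientationTerm id D) t) ∎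
    where open ≡-Reasoning

  lookup-exponent : ∀ {k} (h : Fin k → Fin m) (D : Vec Bool k) v →
    lookup (proj₂ (orientationTerm h D)) v ≡ sum (λ i → boolToℕ (does (endpoint (lookup D i) (h i) FinP.≟ v)))
  lookup-exponent h []      v = VecP.lookup-replicate v 0
  lookup-exponent h (d ∷ D) v =
    trans (VecP.lookup-zipWith ℕ._+_ v (unitExp (endpoint d (h zero))) (proj₂ (orientationTerm (h ∘ suc) D)))
          (cong₂ ℕ._+_ (lookup-unitExp (endpoint d (h zero)) v) (lookup-exponent (h ∘ suc) D v))

  outdeg≡sum : ∀ D v → outdeg G D v ≡ sum (λ e → boolToℕ (does (tail G D e FinP.≟ v)))
  outdeg≡sum D v = length-filter-tabulate (λ e → tail G D e FinP.≟ v) id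

  exponent≡outdegrees : ∀ D → proj₂ (orientationTerm id D) ≡ outdegrees G D
  exponent≡outdegrees D = trans (sym (VecP.tabulate∘lookup _))
    (VecP.tabulate-cong (λ v → trans (lookup-exponent id D v) (sym (outdeg≡sum D v))))

  ∣sign∣≡1 : ∀ {k} (h : Fin k → Fin m) D → ℤ.∣ proj₁ (orientationTerm h D) ∣ ≡ 1
  ∣sign∣≡1 h []      = refl
  ∣sign∣≡1 h (d ∷ D) = trans (ℤP.abs-* (weight d (σ G (h zero))) _)
    (cong₂ ℕ._*_ (∣weight∣≡1 d (σ G (h zero))) (∣sign∣≡1 (h ∘ suc) D))

  sign-⊕ : ∀ {k} (h : Fin k → Fin m) (D S : Vec Bool k) →
    proj₁ (orientationTerm h (D ⊕ S))
      ≡ proj₁ (orientationTerm h D) ℤ.* -1ℤ ^ sum (λ i → boolToℕ (lookup S i ∧ isPos (σ G (h i))))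
  sign-⊕ h []      []      = refl
  sign-⊕ h (d ∷ D) (b ∷ S) = begin
    weight (d xor b) s ℤ.* proj₁ (orientationTerm (h ∘ suc) (D ⊕ S))
      ≡⟨ cong₂ ℤ._*_ (weight-xor d b s) (sign-⊕ (h ∘ suc) D S) ⟩
    (weight d s ℤ.* -1ℤ ^ x) ℤ.* (rest ℤ.* -1ℤ ^ c)
      ≡⟨ interchange (weight d s) (-1ℤ ^ x) rest (-1ℤ ^ c) ⟩
    (weight d s ℤ.* rest) ℤ.* (-1ℤ ^ x ℤ.* -1ℤ ^ c)
      ≡⟨ cong ((weight d s ℤ.* rest) ℤ.*_) (sym (ℤP.^-distribˡ-+-* -1ℤ x c)) ⟩
    (weight d s ℤ.* rest) ℤ.* -1ℤ ^ (x ℕ.+ c) ∎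
    where
    open ≡-Reasoning
    s = σ G (h zero)
    x = boolToℕ (b ∧ isPos s)
    rest = proj₁ (orientationTerm (h ∘ suc) D)
    c = sum (λ i → boolToℕ (lookup S i ∧ isPos (σ G (h (suc i)))))
    interchange : ∀ p q r u → (p ℤ.* q) ℤ.* (r ℤ.* u) ≡ (p ℤ.* r) ℤ.* (q ℤ.* u)
    interchange = solve-∀

  posCount≡sum : ∀ S → posCount G S ≡ sum (λ e → boolToℕ (lookup S e ∧ isPos (σ G e)))
  posCount≡sum S = count-true (λ e → lookup S e ∧ isPos (σ G e))

  tail-⊕ : ∀ D S e → tail G (D ⊕ S) e ≡ (if lookup S e then head G D e else tail G D e)
  tail-⊕ D S e rewrite VecP.lookup-zipWith _xor_ e D S with lookup D e | lookup S e
  ... | true  | true  = refl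
  ... | true  | false = refl
  ... | false | true  = refl
  ... | false | false = refl

  -- Each edge of S leaves v in D ⊕ S exactly when it enters v in D.
  outdeg-⊕ : ∀ D S v → outdeg G (D ⊕ S) v ℕ.+ subOutdeg G D S v ≡ outdeg G D v ℕ.+ subIndeg G D S v
  outdeg-⊕ D S v = begin
    outdeg G (D ⊕ S) v ℕ.+ subOutdeg G D S v
      ≡⟨ cong₂ ℕ._+_ (outdeg≡sum (D ⊕ S) v) (count-true leavesInS) ⟩
    sum (leaves (D ⊕ S)) ℕ.+ sum (boolToℕ ∘ leavesInS)
      ≡⟨ sym (∑-distrib-+ (leaves (D ⊕ S)) (boolToℕ ∘ leavesInS)) ⟩
    sum (λ e → leaves (D ⊕ S) e ℕ.+ boolToℕ (leavesInS e))
      ≡⟨ sum-cong-≗ edgewise ⟩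
    sum (λ e → leaves D e ℕ.+ boolToℕ (entersInS e))
      ≡⟨ ∑-distrib-+ (leaves D) (boolToℕ ∘ entersInS) ⟩
    sum (leaves D) ℕ.+ sum (boolToℕ ∘ entersInS)
      ≡⟨ sym (cong₂ ℕ._+_ (outdeg≡sum D v) (count-true entersInS)) ⟩
    outdeg G D v ℕ.+ subIndeg G D S v ∎
    where
    open ≡-Reasoning
    leaves : Orientation m → Fin m → ℕ
    leaves D′ e = boolToℕ (does (tail G D′ e FinP.≟ v))
    leavesInS entersInS : Fin m → Bool
    leavesInS e = lookup S e ∧ ⌊ tail G D e FinP.≟ v ⌋
    entersInS e = lookup S e ∧ ⌊ head G D e FinP.≟ v ⌋
    edgewise : ∀ e → leaves (D ⊕ S) e ℕ.+ boolToℕ (leavesInS e) ≡ leaves D e ℕ.+ boolToℕ (entersInS e)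
    edgewise e rewrite tail-⊕ D S e with lookup S e
    ... | true  rewrite isYes≗does (tail G D e FinP.≟ v) | isYes≗does (head G D e FinP.≟ v) =
      ℕP.+-comm (boolToℕ (does (head G D e FinP.≟ v))) _
    ... | false = refl

  outdegrees-⊕⇔Eulerian : ∀ D S → (outdegrees G (D ⊕ S) ≡ outdegrees G D) ⇔ Eulerian G D S
  outdegrees-⊕⇔Eulerian D S = mk⇔ to from
    where
    to : outdegrees G (D ⊕ S) ≡ outdegrees G D → Eulerian G D S
    to same v = sym (ℕP.+-cancelˡ-≡ (outdeg G D v) _ _
      (trans (cong (ℕ._+ subOutdeg G D S v) (sym same-v)) (outdeg-⊕ D S v)))
      where
      same-v : outdeg G (D ⊕ S) v ≡ outdeg G D v
      same-v = trans (sym (VecP.lookup∘tabulate _ v))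
        (trans (cong (λ d → lookup d v) same) (VecP.lookup∘tabulate _ v))
    from : Eulerian G D S → outdegrees G (D ⊕ S) ≡ outdegrees G D
    from eul = VecP.tabulate-cong (λ v → ℕP.+-cancelʳ-≡ (subOutdeg G D S v) _ _
      (trans (outdeg-⊕ D S v) (cong (outdeg G D v ℕ.+_) (eul v))))

  coeff-outdegrees : ∀ D →
    coeff (graphPoly G) (outdegrees G D) ≡ sign D ℤ.* (+ numσEE G D ℤ.- + numσOE G D)
  coeff-outdegrees D = begin
    coeff (graphPoly G) (outdegrees G D)
      ≡⟨ coeff-graphPoly (outdegrees G D) ⟩
    sumOver (allSubsets m) (λ D′ → coefficientOf (orientationTerm id D′) (outdegrees G D))
      ≡⟨ sumOver-allSubsets-⊕ D _ ⟩
    sumOver (allSubsets m) (λ S → coefficientOf (orientationTerm id (D ⊕ S)) (outdegrees G D))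
      ≡⟨ sumOver-cong (allSubsets m) reversal ⟩
    sumOver (allSubsets m) (λ S → sign D ℤ.* eulerianSign S)
      ≡⟨ sumOver-*ˡ (allSubsets m) (sign D) eulerianSign ⟩
    sign D ℤ.* sumOver (allSubsets m) eulerianSign
      ≡⟨ cong (sign D ℤ.*_) (sumOver-signedIndicator (Eulerian? G D) (posCount G) (allSubsets m)) ⟩
    sign D ℤ.* (+ numσEE G D ℤ.- + numσOE G D) ∎
    where
    open ≡-Reasoning
    eulerianSign : EdgeSubset m → ℤ
    eulerianSign S = if does (Eulerian? G D S) then -1ℤ ^ posCount G S else 0ℤ
    reversal : ∀ S → coefficientOf (orientationTerm id (D ⊕ S)) (outdegrees G D) ≡ sign D ℤ.* eulerianSign S
    reversal S = begin
      (if does (VecP.≡-dec ℕP._≟_ (proj₂ (orientationTerm id (D ⊕ S))) (outdegrees G D))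
        then sign (D ⊕ S) else 0ℤ)
        ≡⟨ cong (λ b → if b then sign (D ⊕ S) else 0ℤ)
             (does-⇔ same⇔Eulerian (VecP.≡-dec ℕP._≟_ _ _) (Eulerian? G D S)) ⟩
      (if does (Eulerian? G D S) then sign (D ⊕ S) else 0ℤ)
        ≡⟨ cong (λ z → if does (Eulerian? G D S) then z else 0ℤ)
             (trans (sign-⊕ id D S) (cong (λ c → sign D ℤ.* -1ℤ ^ c) (sym (posCount≡sum S)))) ⟩
      (if does (Eulerian? G D S) then sign D ℤ.* -1ℤ ^ posCount G S else 0ℤ)
        ≡⟨ if-then-*-else-0 (does (Eulerian? G D S)) (sign D) _ ⟩
      sign D ℤ.* eulerianSign S ∎
      where
      same⇔Eulerian : (proj₂ (orientationTerm id (D ⊕ S)) ≡ outdegrees G D) ⇔ Eulerian G D S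
      same⇔Eulerian = mk⇔
        (Equivalence.to (outdegrees-⊕⇔Eulerian D S) ∘ trans (sym (exponent≡outdegrees (D ⊕ S))))
        (trans (exponent≡outdegrees (D ⊕ S)) ∘ Equivalence.from (outdegrees-⊕⇔Eulerian D S))

  ATWitness⇒OrientWitness : ∀ k → ATWitness G k → OrientWitness G k
  ATWitness⇒OrientWitness k (t , coeff≢0 , t<k) = D , counts≢ , outdeg<k
    where
    nonzeroTerm = sumOver≢0⇒∃ (allSubsets m) _ (coeff≢0 ∘ trans (coeff-graphPoly t))
    D = proj₁ nonzeroTerm
    outdegrees≡t : outdegrees G D ≡ t
    outdegrees≡t = trans (sym (exponent≡outdegrees D))
      (coefficientOf≢0⇒≡ (orientationTerm id D) t (proj₂ nonzeroTerm))
    counts≢ : numσEE G D ≢ numσOE G D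
    counts≢ EE≡OE = coeff≢0 (begin
      coeff (graphPoly G) t                       ≡⟨ cong (coeff (graphPoly G)) (sym outdegrees≡t) ⟩
      coeff (graphPoly G) (outdegrees G D)        ≡⟨ coeff-outdegrees D ⟩
      sign D ℤ.* (+ numσEE G D ℤ.- + numσOE G D)  ≡⟨ cong (sign D ℤ.*_) (ℤP.i≡j⇒i-j≡0 (cong +_ EE≡OE)) ⟩
      sign D ℤ.* 0ℤ                               ≡⟨ ℤP.*-zeroʳ (sign D) ⟩
      0ℤ                                          ∎)
      where open ≡-Reasoning
    outdeg<k : ∀ v → outdeg G D v ℕ.< k
    outdeg<k v = subst (ℕ._< k)
      (trans (cong (λ u → lookup u v) (sym outdegrees≡t)) (VecP.lookup∘tabulate _ v)) (t<k v)

  OrientWitness⇒ATWitness : ∀ k → OrientWitness G k → ATWitness G k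
  OrientWitness⇒ATWitness k (D , counts≢ , outdeg<k) = outdegrees G D , coeff≢0 , outdegrees<k
    where
    coeff≢0 : coeff (graphPoly G) (outdegrees G D) ≢ 0ℤ
    coeff≢0 coeff≡0 with ℤP.i*j≡0⇒i≡0∨j≡0 (sign D) (trans (sym (coeff-outdegrees D)) coeff≡0)
    ... | inj₁ sign≡0   = ℕP.0≢1+n (trans (sym (cong ℤ.∣_∣ sign≡0)) (∣sign∣≡1 id D))
    ... | inj₂ counts≡0 = counts≢ (ℤP.+-injective (ℤP.i-j≡0⇒i≡j _ _ counts≡0))
    outdegrees<k : ∀ v → lookup (outdegrees G D) v ℕ.< k
    outdegrees<k v = subst (ℕ._< k) (sym (VecP.lookup∘tabulate _ v)) (outdeg<k v)

IsMinimum-transfer : ∀ {P Q : ℕ → Set} → (∀ j → P j → Q j) → (∀ j → Q j → P j) →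
  ∀ k → IsMinimum P k → IsMinimum Q k
IsMinimum-transfer P⇒Q Q⇒P k (Pk , minimal) = P⇒Q k Pk , λ j Qj → minimal j (Q⇒P j Qj)

corollary2p3 : ∀ {n m} (G : SignedGraph n m) (k : ℕ) →
    (IsMinimum (ATWitness G) k → IsMinimum (OrientWitness G) k) ×
    (IsMinimum (OrientWitness G) k → IsMinimum (ATWitness G) k)
corollary2p3 G k =
  IsMinimum-transfer (ATWitness⇒OrientWitness G) (OrientWitness⇒ATWitness G) k ,
  IsMinimum-transfer (OrientWitness⇒ATWitness G) (ATWitness⇒OrientWitness G) k
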